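{- A Heyting algebra $\boldsymbol{A}$ validates a Sahlqvist quasiequation $\Phi$ if and only if it validates every formula in $\mathsf{A}(\Phi)$.
   Context: Sahlqvist quasiequations over $\{\wedge,\vee,\to,\neg,0,1\}$: an occurrence of a variable is positive (negative) if the number of negations and antecedents of implications in whose scope it lies is even (odd); a formula is positive (negative) if all its occurrences are. Sahlqvist antecedent: built from variables, negative formulas and $0,1$ using $\wedge,\vee$ only. Sahlqvist implication: positive, or $\neg\varphi$ with $\varphi$ a Sahlqvist antecedent, or $\varphi\to\psi$ with $\varphi$ a Sahlqvist antecedent, $\psi$ positive. $\Phi=(\varphi_1\wedge y\le z\ \&\cdots\&\ \varphi_m\wedge y\le z\Longrightarrow y\le z)$ with $y,z$ distinct variables not in the $\varphi_i$, each $\varphi_i$ built from Sahlqvist implications by $\wedge,\vee$, $a\le b$ abbreviating $a\wedge b\approx a$. A formula $\varphi$ is valid in a Heyting algebra if $\varphi\approx1$ holds in it. Definition of $\mathsf{A}(\Phi)$: let ${\sim_p}(x_1,\dots,x_p)=\{x_1\to(\cdots(x_p\to0)\cdots)\}$, $(x_1,\dots,x_p)\Rightarrow_{pt}(y_1,\dots,y_t)=\{x_1\to(\cdots(x_p\to y_j)\cdots): j\le t\}$, $(x_1,\dots,x_p)\curlyvee_{pt}(y_1,\dots,y_t)=\{x_i\vee y_j\}$, and $\top(x)$ a fixed theorem of intuitionistic logic in variable $x$. For $\varphi(x_1,\dots,x_n)$ and $k\in\mathbb{Z}^+$: $\boldsymbol{x_j}^k=\{x_j^1,\dots,x_j^k\}$,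 $\boldsymbol1^k=\{\top(x_1^1)\}$, $\boldsymbol0^k=\{x_1^1\}\cup{\sim_1}(x_1^1)$, $(\boldsymbol{\psi\wedge\chi})^k=\boldsymbol\psi^k\cup\boldsymbol\chi^k$, and with $\boldsymbol\psi^k=\{\psi_1..\psi_p\}$, $\boldsymbol\chi^k=\{\chi_1..\chi_t\}$: $(\boldsymbol{\neg\psi})^k={\sim_p}(\psi_1..\psi_p)$, $(\boldsymbol{\psi\to\chi})^k=(\psi_1..\psi_p)\Rightarrow_{pt}(\chi_1..\chi_t)$, $(\boldsymbol{\psi\vee\chi})^k=(\psi_1..\psi_p)\curlyvee_{pt}(\chi_1..\chi_t)$. For finite $\Gamma=\{\gamma_1..\gamma_p\}$, $\Gamma\to\varphi$ is $\{\gamma_1\to(\cdots(\gamma_p\to\varphi)\cdots)\}$. $\mathsf{A}(\Phi)=\bigcup_{k\in\mathbb{Z}^+}\big(((\boldsymbol{\varphi_1}^k\to y)\cup\cdots\cup(\boldsymbol{\varphi_m}^k\to y))\to y\big)$ with $y$ a variable not in the $\boldsymbol{\varphi_i}^k$. -}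

module Defs where

open import Level using (Level)
open import Data.Nat using (ℕ; zero; suc)
open import Data.Unit using (tt) renaming (⊤ to Unit)
open import Data.Sum using (_⊎_; inj₁; inj₂)
open import Data.Product using (_×_; _,_)
open import Data.List using (List; []; _∷_; _++_; map; foldr; concatMap; applyUpTo)
open import Data.List.Relation.Unary.All using (All)
open import Relation.Binary.PropositionalEquality using (_≡_)
open import Relation.Nullary using (¬_)
open import Relation.Binary.Lattice.Bundles using (HeytingAlgebra)

infixr 7 _⋀_
infixr 6 _⋁_
infixr 5 _⟶_

data Formula (V : Set) : Set where
  var  : V → Formula V
  _⋀_  : Formula V → Formula V → Formula V
  _⋁_  : Formula V → Formula V → Formula V
  _⟶_  : Formula V → Formula V → Formula V
  ¬'_  : Formula V → Formula V
  𝟘    : Formula V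
  𝟙    : Formula V

rename : {V W : Set} → (V → W) → Formula V → Formula W
rename f (var x)   = var (f x)
rename f (φ ⋀ ψ)   = rename f φ ⋀ rename f ψ
rename f (φ ⋁ ψ)   = rename f φ ⋁ rename f ψ
rename f (φ ⟶ ψ)   = rename f φ ⟶ rename f ψ
rename f (¬' φ)    = ¬' rename f φ
rename f 𝟘         = 𝟘
rename f 𝟙         = 𝟙

data Occurs {V : Set} (x : V) : Formula V → Set where
  here  : Occurs x (var x)
  ∧ˡ    : ∀ {φ ψ} → Occurs x φ → Occurs x (φ ⋀ ψ)
  ∧ʳ    : ∀ {φ ψ} → Occurs x ψ → Occurs x (φ ⋀ ψ)
  ∨ˡ    : ∀ {φ ψ} → Occurs x φ → Occurs x (φ ⋁ ψ)
  ∨ʳ    : ∀ {φ ψ} → Occurs x ψ → Occurs x (φ ⋁ ψ)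
  →ˡ    : ∀ {φ ψ} → Occurs x φ → Occurs x (φ ⟶ ψ)
  →ʳ    : ∀ {φ ψ} → Occurs x ψ → Occurs x (φ ⟶ ψ)
  neg   : ∀ {φ} → Occurs x φ → Occurs x (¬' φ)

data Positive {V : Set} : Formula V → Set
data Negative {V : Set} : Formula V → Set

data Positive {V} where
  var : ∀ x → Positive (var x)
  _⋀_ : ∀ {φ ψ} → Positive φ → Positive ψ → Positive (φ ⋀ ψ)
  _⋁_ : ∀ {φ ψ} → Positive φ → Positive ψ → Positive (φ ⋁ ψ)
  _⟶_ : ∀ {φ ψ} → Negative φ → Positive ψ → Positive (φ ⟶ ψ)
  ¬'_ : ∀ {φ} → Negative φ → Positive (¬' φ)
  𝟘   : Positive 𝟘
  𝟙   : Positive 𝟙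

data Negative {V} where
  _⋀_ : ∀ {φ ψ} → Negative φ → Negative ψ → Negative (φ ⋀ ψ)
  _⋁_ : ∀ {φ ψ} → Negative φ → Negative ψ → Negative (φ ⋁ ψ)
  _⟶_ : ∀ {φ ψ} → Positive φ → Negative ψ → Negative (φ ⟶ ψ)
  ¬'_ : ∀ {φ} → Positive φ → Negative (¬' φ)
  𝟘   : Negative 𝟘
  𝟙   : Negative 𝟙

data SahlqvistAntecedent {V : Set} : Formula V → Set where
  var : ∀ x → SahlqvistAntecedent (var x)
  neg : ∀ {φ} → Negative φ → SahlqvistAntecedent φ
  𝟘   : SahlqvistAntecedent 𝟘
  𝟙   : SahlqvistAntecedent 𝟙
  _⋀_ : ∀ {φ ψ} → SahlqvistAntecedent φ → SahlqvistAntecedent ψ →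
        SahlqvistAntecedent (φ ⋀ ψ)
  _⋁_ : ∀ {φ ψ} → SahlqvistAntecedent φ → SahlqvistAntecedent ψ →
        SahlqvistAntecedent (φ ⋁ ψ)

data SahlqvistImplication {V : Set} : Formula V → Set where
  pos : ∀ {φ} → Positive φ → SahlqvistImplication φ
  neg : ∀ {φ} → SahlqvistAntecedent φ → SahlqvistImplication (¬' φ)
  imp : ∀ {φ ψ} → SahlqvistAntecedent φ → Positive ψ →
        SahlqvistImplication (φ ⟶ ψ)

data SahlqvistPremise {V : Set} : Formula V → Set where
  base : ∀ {φ} → SahlqvistImplication φ → SahlqvistPremise φ
  _⋀_  : ∀ {φ ψ} → SahlqvistPremise φ → SahlqvistPremise ψ →
         SahlqvistPremise (φ ⋀ ψ)
  _⋁_  : ∀ {φ ψ} → SahlqvistPremise φ → SahlqvistPremise ψ →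
         SahlqvistPremise (φ ⋁ ψ)

-- A Sahlqvist quasiequation
--   φ₁ ∧ y ≤ z & ⋯ & φₘ ∧ y ≤ z ⟹ y ≤ z
-- over variables x₀, x₁, … (encoded as ℕ).
record SahlqvistQuasiequation : Set where
  field
    premises  : List (Formula ℕ)
    y z       : ℕ
    y≢z       : ¬ (y ≡ z)
    y-fresh   : All (λ φ → ¬ Occurs y φ) premises
    z-fresh   : All (λ φ → ¬ Occurs z φ) premises
    sahlqvist : All SahlqvistPremise premises

module _ {c ℓ₁ ℓ₂ : Level} (H : HeytingAlgebra c ℓ₁ ℓ₂) where
  open HeytingAlgebra H

  ⟦_⟧ : {V : Set} → Formula V → (V → Carrier) → Carrier
  ⟦ var x ⟧ v = v x
  ⟦ φ ⋀ ψ ⟧ v = ⟦ φ ⟧ v ∧ ⟦ ψ ⟧ v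
  ⟦ φ ⋁ ψ ⟧ v = ⟦ φ ⟧ v ∨ ⟦ ψ ⟧ v
  ⟦ φ ⟶ ψ ⟧ v = ⟦ φ ⟧ v ⇨ ⟦ ψ ⟧ v
  ⟦ ¬' φ ⟧ v  = ⟦ φ ⟧ v ⇨ ⊥
  ⟦ 𝟘 ⟧ v     = ⊥
  ⟦ 𝟙 ⟧ v     = ⊤

  Valid : {V : Set} → Formula V → Set (c Level.⊔ ℓ₁)
  Valid {V} φ = (v : V → Carrier) → ⟦ φ ⟧ v ≈ ⊤

  _≤ₑ_ : Carrier → Carrier → Set ℓ₁
  a ≤ₑ b = (a ∧ b) ≈ a

  ValidQ : SahlqvistQuasiequation → Set (c Level.⊔ ℓ₁)
  ValidQ Φ = (v : ℕ → Carrier) →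
             All (λ φ → (⟦ φ ⟧ v ∧ v y) ≤ₑ v z) premises →
             v y ≤ₑ v z
    where open SahlqvistQuasiequation Φ

-- Variables of the formulas in 𝖠(Φ): inj₂ (j , l) is x_j^l, inj₁ tt is y.
OutVar : Set
OutVar = Unit ⊎ (ℕ × ℕ)

x^ : ℕ → ℕ → Formula OutVar
x^ j l = var (inj₂ (j , l))

yOut : Formula OutVar
yOut = var (inj₁ tt)

_⇛_ : {V : Set} → List (Formula V) → Formula V → Formula V
Γ ⇛ φ = foldr _⟶_ φ Γ

∼ : List (Formula OutVar) → Formula OutVar
∼ Γ = Γ ⇛ 𝟘

-- bold φ^k, given a fixed intuitionistic theorem ⊤(x) in one variable
-- (τ : Formula Unit) and k.  The distinguished variable x₁ of the paper
-- is variable 0 here.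
bold : Formula Unit → ℕ → Formula ℕ → List (Formula OutVar)
bold τ k (var j) = applyUpTo (λ i → x^ j (suc i)) k
bold τ k 𝟙       = rename (λ _ → inj₂ (0 , 1)) τ ∷ []
bold τ k 𝟘       = x^ 0 1 ∷ ∼ (x^ 0 1 ∷ []) ∷ []
bold τ k (φ ⋀ ψ) = bold τ k φ ++ bold τ k ψ
bold τ k (¬' φ)  = ∼ (bold τ k φ) ∷ []
bold τ k (φ ⟶ ψ) = map (λ χ → bold τ k φ ⇛ χ) (bold τ k ψ)
bold τ k (φ ⋁ ψ) = concatMap (λ α → map (λ β → α ⋁ β) (bold τ k ψ)) (bold τ k φ)

𝖠 : Formula Unit → SahlqvistQuasiequation → ℕ → Formula OutVar
𝖠 τ Φ k = map (λ φ → bold τ k φ ⇛ yOut) premises ⇛ yOut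
  where open SahlqvistQuasiequation Φ

-- τ is a theorem of intuitionistic logic (semantically: valid in every
-- Heyting algebra of the given universe levels)
IntuitionisticTheorem : (c ℓ₁ ℓ₂ : Level) → Formula Unit → Set (Level.suc (c Level.⊔ ℓ₁ Level.⊔ ℓ₂))
IntuitionisticTheorem c ℓ₁ ℓ₂ τ = (B : HeytingAlgebra c ℓ₁ ℓ₂) → Valid B τ

-- Write ⋀Γ for the meet of a finite set of formulas.  Up to ≈, ⋀φ^k is
-- ⟦φ⟧ under the valuation x_j ↦ x_j¹ ∧ ⋯ ∧ x_jᵏ: the clauses defining φ^k
-- are matched by currying (for Γ → φ), distributivity of ⇨ and of ∨ over ∧
-- (for → and ∨) and x ∧ ¬x = 0 (for 0).  So the k-th member of 𝖠(Φ)
-- denotes a ⇨ y with a = ⋀ᵢ (⟦φᵢ⟧ ⇨ y), the φᵢ evaluated at that valuation,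
-- and it is valid iff always a ≤ y.  The quasiequation instantiated at
-- y := a, z := y (legitimate as y, z are fresh) gives exactly this; conversely
-- for k = 1 every valuation of the quasiequation arises, giving it back.
module Submission where

open import Defs hiding (⟦_⟧)
import Defs
open import Level using (Level)
open import Data.Nat using (ℕ; _≤_; s≤s; z≤n; _≟_)
open import Data.Unit using (tt) renaming (⊤ to Unit)
open import Data.Product using (_×_; _,_)
open import Data.Sum using (inj₁; inj₂)
open import Data.List using (List; []; _∷_; _++_; map; concatMap)
open import Data.List.Relation.Unary.All as All using (All; []; _∷_)
open import Data.List.Relation.Unary.All.Properties using (map⁺; map⁻)
open import Data.Empty using (⊥-elim)
open import Function using (_∘_)
open import Relation.Nullary using (yes; no; ¬_)
open import Relation.Binary.PropositionalEquality as ≡ using (_≡_; _≢_)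
open import Relation.Binary.Lattice.Bundles using (HeytingAlgebra)
import Relation.Binary.Lattice.Properties.HeytingAlgebra as HeytingProperties
import Relation.Binary.Lattice.Properties.DistributiveLattice as DistributiveProperties
import Relation.Binary.Lattice.Properties.BoundedMeetSemilattice as BoundedMeetProperties
import Relation.Binary.Lattice.Properties.BoundedLattice as BoundedProperties
import Relation.Binary.Lattice.Properties.MeetSemilattice as MeetProperties
import Relation.Binary.Reasoning.Setoid as ≈-Reasoning
import Relation.Binary.Reasoning.PartialOrder as ⊑-Reasoning

infixl 9 _[_≔_]

_[_≔_] : {ℓ : Level} {C : Set ℓ} → (ℕ → C) → ℕ → C → ℕ → C
(v [ x ≔ a ]) j with j ≟ x
... | yes _ = a
... | no  _ = v j

[≔]-same : {ℓ : Level} {C : Set ℓ} (v : ℕ → C) (x : ℕ) (a : C) → (v [ x ≔ a ]) x ≡ a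
[≔]-same v x a with x ≟ x
... | yes _   = ≡.refl
... | no  x≢x = ⊥-elim (x≢x ≡.refl)

[≔]-other : {ℓ : Level} {C : Set ℓ} (v : ℕ → C) {x j : ℕ} (a : C) → j ≢ x → (v [ x ≔ a ]) j ≡ v j
[≔]-other v {x} {j} a j≢x with j ≟ x
... | yes j≡x = ⊥-elim (j≢x j≡x)
... | no  _   = ≡.refl

occurs-≢ : {V : Set} {j x : V} {φ : Formula V} → Occurs j φ → ¬ Occurs x φ → j ≢ x
occurs-≢ j∈φ x∉φ ≡.refl = x∉φ j∈φ

module HeytingSemantics {c ℓ₁ ℓ₂ : Level} (H : HeytingAlgebra c ℓ₁ ℓ₂) where
  open HeytingAlgebra H renaming (_≤_ to _⊑_)
  open HeytingProperties H using (⇨-eval; swap-transpose-⇨; y≤x⇨y; ⇨-applyʳ; ⇨-cong; ⇨-curry; ⇨-distribˡ-∧)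
  open DistributiveProperties (HeytingProperties.distributiveLattice H) using (∨-distribˡ-∧; ∨-distribʳ-∧)
  open BoundedMeetProperties boundedMeetSemilattice using (identityˡ; identityʳ)
  open BoundedProperties boundedLattice using (∨-zeroˡ; ∨-zeroʳ)
  open MeetProperties meetSemilattice using (∧-assoc; ∧-cong; ∧-monotonic)
  open import Relation.Binary.Lattice.Properties.JoinSemilattice joinSemilattice using (∨-cong)

  ⇨-identityˡ : ∀ x → ⊤ ⇨ x ≈ x
  ⇨-identityˡ x = antisym (trans (∧-greatest refl (maximum _)) ⇨-eval) y≤x⇨y

  ⇨-zeroʳ : ∀ x → x ⇨ ⊤ ≈ ⊤
  ⇨-zeroʳ x = antisym (maximum _) y≤x⇨y

  x∧[x⇨⊥]≈⊥ : ∀ x → x ∧ (x ⇨ ⊥) ≈ ⊥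
  x∧[x⇨⊥]≈⊥ x = antisym (⇨-applyʳ refl) (minimum _)

  ⊑⇒⇨≈⊤ : ∀ {x y} → x ⊑ y → x ⇨ y ≈ ⊤
  ⊑⇒⇨≈⊤ x⊑y = antisym (maximum _) (transpose-⇨ (trans (x∧y≤y _ _) x⊑y))

  ⇨≈⊤⇒⊑ : ∀ {x y} → x ⇨ y ≈ ⊤ → x ⊑ y
  ⇨≈⊤⇒⊑ x⇨y≈⊤ = trans (∧-greatest (trans (maximum _) (reflexive (Eq.sym x⇨y≈⊤))) refl) ⇨-eval

  ⊑⇒≤ₑ : ∀ {x y} → x ⊑ y → _≤ₑ_ H x y
  ⊑⇒≤ₑ x⊑y = antisym (x∧y≤x _ _) (∧-greatest refl x⊑y)

  ≤ₑ⇒⊑ : ∀ {x y} → _≤ₑ_ H x y → x ⊑ y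
  ≤ₑ⇒⊑ x∧y≈x = trans (reflexive (Eq.sym x∧y≈x)) (x∧y≤y _ _)

  ⟦_⟧ : {V : Set} → Formula V → (V → Carrier) → Carrier
  ⟦_⟧ = Defs.⟦_⟧ H

  ⟦⟧-rename : {V W : Set} (f : V → W) (φ : Formula V) (w : W → Carrier) →
              ⟦ rename f φ ⟧ w ≡ ⟦ φ ⟧ (w ∘ f)
  ⟦⟧-rename f (var x) w = ≡.refl
  ⟦⟧-rename f (φ ⋀ ψ) w = ≡.cong₂ _∧_ (⟦⟧-rename f φ w) (⟦⟧-rename f ψ w)
  ⟦⟧-rename f (φ ⋁ ψ) w = ≡.cong₂ _∨_ (⟦⟧-rename f φ w) (⟦⟧-rename f ψ w)
  ⟦⟧-rename f (φ ⟶ ψ) w = ≡.cong₂ _⇨_ (⟦⟧-rename f φ w) (⟦⟧-rename f ψ w)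
  ⟦⟧-rename f (¬' φ)  w = ≡.cong (_⇨ ⊥) (⟦⟧-rename f φ w)
  ⟦⟧-rename f 𝟘       w = ≡.refl
  ⟦⟧-rename f 𝟙       w = ≡.refl

  ⋀⟦_⟧ : {V : Set} → List (Formula V) → (V → Carrier) → Carrier
  ⋀⟦ []    ⟧ w = ⊤
  ⋀⟦ γ ∷ Γ ⟧ w = ⟦ γ ⟧ w ∧ ⋀⟦ Γ ⟧ w

  module _ {V : Set} (w : V → Carrier) where
    open ≈-Reasoning setoid

    ⋀⟦[-]⟧ : (γ : Formula V) → ⋀⟦ γ ∷ [] ⟧ w ≈ ⟦ γ ⟧ w
    ⋀⟦[-]⟧ γ = identityʳ _

    ⊑-⋀⟦⟧⁺ : ∀ {x} (Γ : List (Formula V)) → All (λ γ → x ⊑ ⟦ γ ⟧ w) Γ → x ⊑ ⋀⟦ Γ ⟧ w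
    ⊑-⋀⟦⟧⁺ []      []         = maximum _
    ⊑-⋀⟦⟧⁺ (γ ∷ Γ) (x⊑γ ∷ x⊑Γ) = ∧-greatest x⊑γ (⊑-⋀⟦⟧⁺ Γ x⊑Γ)

    ⊑-⋀⟦⟧⁻ : ∀ {x} (Γ : List (Formula V)) → x ⊑ ⋀⟦ Γ ⟧ w → All (λ γ → x ⊑ ⟦ γ ⟧ w) Γ
    ⊑-⋀⟦⟧⁻ []      _   = []
    ⊑-⋀⟦⟧⁻ (γ ∷ Γ) x⊑Γ =
      trans x⊑Γ (x∧y≤x _ _) ∷ ⊑-⋀⟦⟧⁻ Γ (trans x⊑Γ (x∧y≤y _ _))

    ⋀⟦⟧-++ : (Γ Δ : List (Formula V)) → ⋀⟦ Γ ++ Δ ⟧ w ≈ ⋀⟦ Γ ⟧ w ∧ ⋀⟦ Δ ⟧ w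
    ⋀⟦⟧-++ []      Δ = Eq.sym (identityˡ _)
    ⋀⟦⟧-++ (γ ∷ Γ) Δ = begin
      ⟦ γ ⟧ w ∧ ⋀⟦ Γ ++ Δ ⟧ w             ≈⟨ ∧-cong Eq.refl (⋀⟦⟧-++ Γ Δ) ⟩
      ⟦ γ ⟧ w ∧ (⋀⟦ Γ ⟧ w ∧ ⋀⟦ Δ ⟧ w)     ≈⟨ Eq.sym (∧-assoc _ _ _) ⟩
      (⟦ γ ⟧ w ∧ ⋀⟦ Γ ⟧ w) ∧ ⋀⟦ Δ ⟧ w     ∎

    ⟦⇛⟧ : (Γ : List (Formula V)) (ψ : Formula V) → ⟦ Γ ⇛ ψ ⟧ w ≈ ⋀⟦ Γ ⟧ w ⇨ ⟦ ψ ⟧ w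
    ⟦⇛⟧ []      ψ = Eq.sym (⇨-identityˡ _)
    ⟦⇛⟧ (γ ∷ Γ) ψ = begin
      ⟦ γ ⟧ w ⇨ ⟦ Γ ⇛ ψ ⟧ w                ≈⟨ ⇨-cong Eq.refl (⟦⇛⟧ Γ ψ) ⟩
      ⟦ γ ⟧ w ⇨ (⋀⟦ Γ ⟧ w ⇨ ⟦ ψ ⟧ w)        ≈⟨ Eq.sym ⇨-curry ⟩
      ⟦ γ ⟧ w ∧ ⋀⟦ Γ ⟧ w ⇨ ⟦ ψ ⟧ w          ∎

    ⋀⟦⟧-map-⇛ : (Γ Δ : List (Formula V)) → ⋀⟦ map (Γ ⇛_) Δ ⟧ w ≈ ⋀⟦ Γ ⟧ w ⇨ ⋀⟦ Δ ⟧ w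
    ⋀⟦⟧-map-⇛ Γ []      = Eq.sym (⇨-zeroʳ _)
    ⋀⟦⟧-map-⇛ Γ (χ ∷ Δ) = begin
      ⟦ Γ ⇛ χ ⟧ w ∧ ⋀⟦ map (Γ ⇛_) Δ ⟧ w               ≈⟨ ∧-cong (⟦⇛⟧ Γ χ) (⋀⟦⟧-map-⇛ Γ Δ) ⟩
      (⋀⟦ Γ ⟧ w ⇨ ⟦ χ ⟧ w) ∧ (⋀⟦ Γ ⟧ w ⇨ ⋀⟦ Δ ⟧ w)    ≈⟨ Eq.sym (⇨-distribˡ-∧ _ _ _) ⟩
      ⋀⟦ Γ ⟧ w ⇨ ⟦ χ ⟧ w ∧ ⋀⟦ Δ ⟧ w                   ∎

    ⋀⟦⟧-map-⋁ : (α : Formula V) (Δ : List (Formula V)) →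
                ⋀⟦ map (α ⋁_) Δ ⟧ w ≈ ⟦ α ⟧ w ∨ ⋀⟦ Δ ⟧ w
    ⋀⟦⟧-map-⋁ α []      = Eq.sym (∨-zeroʳ _)
    ⋀⟦⟧-map-⋁ α (χ ∷ Δ) = begin
      (⟦ α ⟧ w ∨ ⟦ χ ⟧ w) ∧ ⋀⟦ map (α ⋁_) Δ ⟧ w    ≈⟨ ∧-cong Eq.refl (⋀⟦⟧-map-⋁ α Δ) ⟩
      (⟦ α ⟧ w ∨ ⟦ χ ⟧ w) ∧ (⟦ α ⟧ w ∨ ⋀⟦ Δ ⟧ w)   ≈⟨ Eq.sym (∨-distribˡ-∧ _ _ _) ⟩
      ⟦ α ⟧ w ∨ ⟦ χ ⟧ w ∧ ⋀⟦ Δ ⟧ w                 ∎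

    ⋀⟦⟧-concatMap-⋁ : (Γ Δ : List (Formula V)) →
                      ⋀⟦ concatMap (λ α → map (α ⋁_) Δ) Γ ⟧ w ≈ ⋀⟦ Γ ⟧ w ∨ ⋀⟦ Δ ⟧ w
    ⋀⟦⟧-concatMap-⋁ []      Δ = Eq.sym (∨-zeroˡ _)
    ⋀⟦⟧-concatMap-⋁ (γ ∷ Γ) Δ = begin
      ⋀⟦ map (γ ⋁_) Δ ++ concatMap (λ α → map (α ⋁_) Δ) Γ ⟧ w
        ≈⟨ ⋀⟦⟧-++ (map (γ ⋁_) Δ) _ ⟩
      ⋀⟦ map (γ ⋁_) Δ ⟧ w ∧ ⋀⟦ concatMap (λ α → map (α ⋁_) Δ) Γ ⟧ w
        ≈⟨ ∧-cong (⋀⟦⟧-map-⋁ γ Δ) (⋀⟦⟧-concatMap-⋁ Γ Δ) ⟩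
      (⟦ γ ⟧ w ∨ ⋀⟦ Δ ⟧ w) ∧ (⋀⟦ Γ ⟧ w ∨ ⋀⟦ Δ ⟧ w)
        ≈⟨ Eq.sym (∨-distribʳ-∧ _ _ _) ⟩
      ⟦ γ ⟧ w ∧ ⋀⟦ Γ ⟧ w ∨ ⋀⟦ Δ ⟧ w
        ∎

  module _ (τ : Formula Unit) (τ-valid : Valid H τ) (k : ℕ) (w : OutVar → Carrier) where
    open ≈-Reasoning setoid

    ⋀⟦bold⟧ : (φ : Formula ℕ) (v : ℕ → Carrier) →
              (∀ j → Occurs j φ → ⋀⟦ bold τ k (var j) ⟧ w ≈ v j) →
              ⋀⟦ bold τ k φ ⟧ w ≈ ⟦ φ ⟧ v
    ⋀⟦bold⟧ (var j) v hyp = hyp j here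
    ⋀⟦bold⟧ (φ ⋀ ψ) v hyp = Eq.trans (⋀⟦⟧-++ w (bold τ k φ) (bold τ k ψ))
      (∧-cong (⋀⟦bold⟧ φ v (λ j → hyp j ∘ ∧ˡ)) (⋀⟦bold⟧ ψ v (λ j → hyp j ∘ ∧ʳ)))
    ⋀⟦bold⟧ (φ ⋁ ψ) v hyp = Eq.trans (⋀⟦⟧-concatMap-⋁ w (bold τ k φ) (bold τ k ψ))
      (∨-cong (⋀⟦bold⟧ φ v (λ j → hyp j ∘ ∨ˡ)) (⋀⟦bold⟧ ψ v (λ j → hyp j ∘ ∨ʳ)))
    ⋀⟦bold⟧ (φ ⟶ ψ) v hyp = Eq.trans (⋀⟦⟧-map-⇛ w (bold τ k φ) (bold τ k ψ))
      (⇨-cong (⋀⟦bold⟧ φ v (λ j → hyp j ∘ →ˡ)) (⋀⟦bold⟧ ψ v (λ j → hyp j ∘ →ʳ)))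
    ⋀⟦bold⟧ (¬' φ)  v hyp = begin
      ⋀⟦ ∼ (bold τ k φ) ∷ [] ⟧ w    ≈⟨ ⋀⟦[-]⟧ w (∼ (bold τ k φ)) ⟩
      ⟦ bold τ k φ ⇛ 𝟘 ⟧ w          ≈⟨ ⟦⇛⟧ w (bold τ k φ) 𝟘 ⟩
      ⋀⟦ bold τ k φ ⟧ w ⇨ ⊥         ≈⟨ ⇨-cong (⋀⟦bold⟧ φ v (λ j → hyp j ∘ neg)) Eq.refl ⟩
      ⟦ φ ⟧ v ⇨ ⊥                   ∎
    ⋀⟦bold⟧ 𝟘       v hyp = Eq.trans (∧-cong Eq.refl (⋀⟦[-]⟧ w (∼ (x^ 0 1 ∷ [])))) (x∧[x⇨⊥]≈⊥ _)
    ⋀⟦bold⟧ 𝟙       v hyp = begin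
      ⋀⟦ τ₁ ∷ [] ⟧ w                      ≈⟨ ⋀⟦[-]⟧ w τ₁ ⟩
      ⟦ τ₁ ⟧ w                            ≡⟨ ⟦⟧-rename _ τ w ⟩
      ⟦ τ ⟧ (λ _ → w (inj₂ (0 , 1)))      ≈⟨ τ-valid _ ⟩
      ⊤                                   ∎
      where τ₁ = rename (λ _ → inj₂ (0 , 1)) τ

  module _ (τ : Formula Unit) (τ-valid : Valid H τ) (Φ : SahlqvistQuasiequation) where
    open SahlqvistQuasiequation Φ
    open ⊑-Reasoning poset

    𝖠-premises : ℕ → List (Formula OutVar)
    𝖠-premises k = map (λ φ → bold τ k φ ⇛ yOut) premises

    ⟦𝖠⟧ : ∀ k w → ⟦ 𝖠 τ Φ k ⟧ w ≈ ⋀⟦ 𝖠-premises k ⟧ w ⇨ w (inj₁ tt)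
    ⟦𝖠⟧ k w = ⟦⇛⟧ w (𝖠-premises k) yOut

    validQ⇒valid-𝖠 : ValidQ H Φ → ∀ k → Valid H (𝖠 τ Φ k)
    validQ⇒valid-𝖠 validQ k w =
      Eq.trans (⟦𝖠⟧ k w) (⊑⇒⇨≈⊤ (≡.subst₂ _⊑_ v-y v-z (≤ₑ⇒⊑ (validQ v premises-hold))))
      where
      a = ⋀⟦ 𝖠-premises k ⟧ w
      b = w (inj₁ tt)
      v₀ : ℕ → Carrier
      v₀ j = ⋀⟦ bold τ k (var j) ⟧ w
      v : ℕ → Carrier
      v = v₀ [ z ≔ b ] [ y ≔ a ]

      v-y : v y ≡ a
      v-y = [≔]-same _ y a
      v-z : v z ≡ b
      v-z = ≡.trans ([≔]-other _ a (y≢z ∘ ≡.sym)) ([≔]-same v₀ z b)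
      v-other : ∀ {j} → j ≢ y → j ≢ z → v j ≡ v₀ j
      v-other j≢y j≢z = ≡.trans ([≔]-other _ a j≢y) ([≔]-other v₀ b j≢z)

      premise-holds : ∀ {φ} → ¬ Occurs y φ → ¬ Occurs z φ →
                      a ⊑ ⟦ bold τ k φ ⇛ yOut ⟧ w → _≤ₑ_ H (⟦ φ ⟧ v ∧ v y) (v z)
      premise-holds {φ} y∉φ z∉φ a⊑ = ⊑⇒≤ₑ (begin
        ⟦ φ ⟧ v ∧ v y
          ≡⟨ ≡.cong (⟦ φ ⟧ v ∧_) v-y ⟩
        ⟦ φ ⟧ v ∧ a
          ≤⟨ ∧-monotonic (reflexive (Eq.sym bold≈φ)) (trans a⊑ (reflexive (⟦⇛⟧ w (bold τ k φ) yOut))) ⟩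
        ⋀⟦ bold τ k φ ⟧ w ∧ (⋀⟦ bold τ k φ ⟧ w ⇨ b)
          ≤⟨ ⇨-applyʳ refl ⟩
        b
          ≡⟨ ≡.sym v-z ⟩
        v z
          ∎)
        where
        bold≈φ : ⋀⟦ bold τ k φ ⟧ w ≈ ⟦ φ ⟧ v
        bold≈φ = ⋀⟦bold⟧ τ τ-valid k w φ v λ j j∈φ →
          Eq.reflexive (≡.sym (v-other (occurs-≢ j∈φ y∉φ) (occurs-≢ j∈φ z∉φ)))

      premises-hold : All (λ φ → _≤ₑ_ H (⟦ φ ⟧ v ∧ v y) (v z)) premises
      premises-hold = All.zipWith (λ ((y∉φ , z∉φ) , a⊑) → premise-holds y∉φ z∉φ a⊑)
        (All.zip (y-fresh , z-fresh) , map⁻ (⊑-⋀⟦⟧⁻ w (𝖠-premises k) refl))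

    valid-𝖠₁⇒validQ : Valid H (𝖠 τ Φ 1) → ValidQ H Φ
    valid-𝖠₁⇒validQ valid v hyps = ⊑⇒≤ₑ (begin
      v y                     ≤⟨ ⊑-⋀⟦⟧⁺ w (𝖠-premises 1) (map⁺ (All.map (λ {φ} → premise-implied {φ}) hyps)) ⟩
      ⋀⟦ 𝖠-premises 1 ⟧ w     ≤⟨ ⇨≈⊤⇒⊑ (Eq.trans (Eq.sym (⟦𝖠⟧ 1 w)) (valid w)) ⟩
      v z                     ∎)
      where
      w : OutVar → Carrier
      w (inj₁ _)       = v z
      w (inj₂ (j , _)) = v j

      premise-implied : ∀ {φ} → _≤ₑ_ H (⟦ φ ⟧ v ∧ v y) (v z) → v y ⊑ ⟦ bold τ 1 φ ⇛ yOut ⟧ w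
      premise-implied {φ} φ∧y≤z = begin
        v y                            ≤⟨ swap-transpose-⇨ (≤ₑ⇒⊑ φ∧y≤z) ⟩
        ⟦ φ ⟧ v ⇨ v z                  ≈⟨ ⇨-cong (⋀⟦bold⟧ τ τ-valid 1 w φ v (λ j _ → identityʳ (v j))) Eq.refl ⟨
        ⋀⟦ bold τ 1 φ ⟧ w ⇨ v z        ≈⟨ ⟦⇛⟧ w (bold τ 1 φ) yOut ⟨
        ⟦ bold τ 1 φ ⇛ yOut ⟧ w        ∎

open HeytingSemantics using (validQ⇒valid-𝖠; valid-𝖠₁⇒validQ)

proposition9p4 : {c ℓ₁ ℓ₂ : Level} (A : HeytingAlgebra c ℓ₁ ℓ₂)
                 (τ : Formula Unit) → IntuitionisticTheorem c ℓ₁ ℓ₂ τ →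
                 (Φ : SahlqvistQuasiequation) →
                 (ValidQ A Φ → ((k : ℕ) → 1 ≤ k → Valid A (𝖠 τ Φ k)))
                 × (((k : ℕ) → 1 ≤ k → Valid A (𝖠 τ Φ k)) → ValidQ A Φ)
proposition9p4 A τ τ-theorem Φ =
    (λ validQ k _ → validQ⇒valid-𝖠 A τ (τ-theorem A) Φ validQ k)
  , (λ valid-𝖠 → valid-𝖠₁⇒validQ A τ (τ-theorem A) Φ (valid-𝖠 1 (s≤s z≤n)))
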